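{- The proof system D-LD-Q-Res is unsound for DQBF: the DQBF $\forall u\,\forall v\,\exists x(u)\,\exists y(v)\,\exists z(u,v)$ with matrix consisting of the clauses $\{x,v,z\}$, $\{\neg x,\neg v,z\}$, $\{y,u,\neg z\}$, $\{\neg y,\neg u,\neg z\}$ is true, yet the empty clause can be derived from it in D-LD-Q-Res.
   Context: A DQBF has universal variables $Y$, existential variables $X$, a dependency set $Y_x\subseteq Y$ for each $x\in X$ (written $\exists x(Y_x)$), and a CNF matrix over $X\cup Y$ (clauses are sets of literals). It is true iff there are Skolem functions $f_x:\{0,1\}^{Y_x}\to\{0,1\}$ such that for every $\alpha:Y\to\{0,1\}$ the matrix evaluates to $1$ under $\alpha$ extended by $x\mapsto f_x(\alpha\restriction Y_x)$. D-LD-Q-Res (the lifting of long-distance Q-resolution to DQBF, obtained by reading "$\mathrm{ind}(x)<\mathrm{ind}(u)$" as "$u\notin Y_x$") works with clauses that may also contain merged literals $u^*$ for universal variables $u$. Rules: (Axiom) any clause of the matrix; ($\forall$-Red) from $D\cup\{u\}$, $u$ a universal literal, derive $D$, provided $\mathrm{var}(u)\notin Y_{\mathrm{var}(l)}$ for every existential literal $l\in D$; ($\forall$-Red$^*$) same as $\forall$-Red but removing a merged literal $u^*$; (L$\exists$R) from $C_1\cup U_1\cup\{x\}$ and $C_2\cup U_2\cup\{\neg x\}$ with $x$ existential derive $C_1\cup C_2\cup U$, where: whenever $l_1\in C_1$, $l_2\in C_2$ share a variable $z$ then $l_1=l_2\neq z^*$; $U_1,U_2$ contain only universal literals with $\mathrm{var}(U_1)=\mathrm{var}(U_2)$;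 $u\notin Y_x$ for every $u\in\mathrm{var}(U_1)$; whenever $w_1\in U_1$, $w_2\in U_2$ share variable $u$ then $w_1=\neg w_2$ or $w_1=u^*$ or $w_2=u^*$; and $U=\{u^*: u\in\mathrm{var}(U_1)\}$. A derivation of the empty clause $\bot$ is a refutation. -}

module Defs where

open import Data.Nat using (ℕ; zero; suc; _≟_)
open import Data.Bool using (Bool; true; false; if_then_else_)
open import Data.List using (List; []; _∷_; _++_; map)
open import Data.List.Membership.Propositional using (_∈_; _∉_)
open import Data.List.Membership.DecPropositional _≟_ using (_∈?_)
open import Data.List.Relation.Unary.All using (All)
open import Data.List.Relation.Unary.Any using (Any)
open import Data.Product using (Σ; ∃; _×_; _,_)
open import Data.Sum using (_⊎_)
open import Relation.Nullary using (¬_; does)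
open import Relation.Binary.PropositionalEquality using (_≡_; _≢_)
open import Function.Bundles using (_⇔_)

Var : Set
Var = ℕ

-- Literals: positive, negative, and merged (u*) literals.
data Lit : Set where
  pos : Var → Lit
  neg : Var → Lit
  mrg : Var → Lit

var : Lit → Var
var (pos v) = v
var (neg v) = v
var (mrg v) = v

-- complement of an ordinary literal (merged literals are self-complementary here;
-- the complement is only used in the rule side-condition "w1 = ¬ w2")
compl : Lit → Lit
compl (pos v) = neg v
compl (neg v) = pos v
compl (mrg v) = mrg v

-- Clauses are finite sets of literals, represented by lists; two lists denote
-- the same clause iff they have the same elements.
Clause : Set
Clause = List Lit

_≈_ : Clause → Clause → Set
C ≈ D = ∀ l → (l ∈ C) ⇔ (l ∈ D)

record DQBF : Set where
  field
    univ   : List Var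
    exist  : List Var
    dep    : Var → List Var
    matrix : List Clause
open DQBF public

extend : (Φ : DQBF) → ((x : Var) → (Var → Bool) → Bool) → (Var → Bool) → Var → Bool
extend Φ f α v = if does (v ∈? exist Φ) then f v α else α v

litTrue : (Var → Bool) → Lit → Set
litTrue β (pos v) = β v ≡ true
litTrue β (neg v) = β v ≡ false
litTrue β (mrg v) = Data.Empty.⊥
  where import Data.Empty

clauseTrue : (Var → Bool) → Clause → Set
clauseTrue β C = Any (litTrue β) C

matrixTrue : (Var → Bool) → List Clause → Set
matrixTrue β M = All (clauseTrue β) M

DependsOnlyOn : List Var → ((Var → Bool) → Bool) → Set
DependsOnlyOn Y g = ∀ α β → (∀ u → u ∈ Y → α u ≡ β u) → g α ≡ g β

-- A DQBF is true iff there are Skolem functions f_x : {0,1}^{Y_x} → {0,1}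
-- (here: functions of the full assignment depending only on Y_x) such that
-- for every assignment α of the universals the matrix is satisfied.
IsTrue : DQBF → Set
IsTrue Φ = Σ ((x : Var) → (Var → Bool) → Bool) λ f →
             (∀ x → x ∈ exist Φ → DependsOnlyOn (dep Φ x) (f x)) ×
             (∀ (α : Var → Bool) → matrixTrue (extend Φ f α) (matrix Φ))

module _ (Φ : DQBF) where

  IsUnivLit : Lit → Set
  IsUnivLit l = var l ∈ univ Φ

  IsExistLit : Lit → Set
  IsExistLit l = var l ∈ exist Φ

  data Derives : Clause → Set where
    axiom : ∀ {C D} → C ∈ matrix Φ → C ≈ D → Derives D
    -- (∀-Red) and (∀-Red*): from D ∪ {w}, w = u, ¬u or u* with u universal, derive D
    ∀-red : ∀ {C D} (w : Lit) → Derives C →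
            var w ∈ univ Φ →
            C ≈ (w ∷ D) →
            (∀ l → l ∈ D → IsExistLit l → var w ∉ dep Φ (var l)) →
            Derives D
    l∃r : ∀ {A B C} (x : Var) (C₁ C₂ U₁ U₂ : Clause) →
          Derives A → Derives B →
          x ∈ exist Φ →
          A ≈ (C₁ ++ U₁ ++ (pos x ∷ [])) →
          B ≈ (C₂ ++ U₂ ++ (neg x ∷ [])) →
          (∀ l₁ l₂ → l₁ ∈ C₁ → l₂ ∈ C₂ → var l₁ ≡ var l₂ →
             (l₁ ≡ l₂) × (l₁ ≢ mrg (var l₁))) →
          (∀ w → w ∈ U₁ → IsUnivLit w) →
          (∀ w → w ∈ U₂ → IsUnivLit w) →
          (∀ u → (Any (λ w → var w ≡ u) U₁) ⇔ (Any (λ w → var w ≡ u) U₂)) →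
          (∀ w → w ∈ U₁ → var w ∉ dep Φ x) →
          (∀ w₁ w₂ → w₁ ∈ U₁ → w₂ ∈ U₂ → var w₁ ≡ var w₂ →
             (w₁ ≡ compl w₂) ⊎ (w₁ ≡ mrg (var w₁)) ⊎ (w₂ ≡ mrg (var w₂))) →
          C ≈ (C₁ ++ C₂ ++ map (λ w → mrg (var w)) U₁) →
          Derives C

  Refutable : Set
  Refutable = Derives []

-- The specific DQBF: u = 0, v = 1, x = 2, y = 3, z = 4.
-- ∀u ∀v ∃x(u) ∃y(v) ∃z(u,v).

exampleDep : Var → List Var
exampleDep 2 = 0 ∷ []
exampleDep 3 = 1 ∷ []
exampleDep 4 = 0 ∷ 1 ∷ []
exampleDep _ = []

example : DQBF
example = record
  { univ   = 0 ∷ 1 ∷ []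
  ; exist  = 2 ∷ 3 ∷ 4 ∷ []
  ; dep    = exampleDep
  ; matrix = (pos 2 ∷ pos 1 ∷ pos 4 ∷ [])
           ∷ (neg 2 ∷ neg 1 ∷ pos 4 ∷ [])
           ∷ (pos 3 ∷ pos 0 ∷ neg 4 ∷ [])
           ∷ (neg 3 ∷ neg 0 ∷ neg 4 ∷ [])
           ∷ []
  }

-- The formula is true: x := u, y := ¬v, z := (u ↔ v) are Skolem functions respecting the
-- dependencies. The refutation resolves on x and on y, merging v and u respectively; each merge
-- is allowed because v ∉ Y_x and u ∉ Y_y. Resolving the merged clauses {z, v*} and {¬z, u*} on z
-- leaves {v*, u*}, and since no existential literal remains both merged literals can be
-- ∀-reduced.
module Submission where

open import Defs
open import Data.Bool using (Bool; true; false; not)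
open import Data.Bool.Properties using () renaming (_≟_ to _≟ᵇ_)
open import Data.Nat using (_≟_)
open import Data.Product using (_×_; _,_)
open import Data.Sum using (inj₁)
open import Data.Empty using (⊥-elim)
open import Data.Unit using (tt)
open import Data.List using ([]; _∷_; _++_)
open import Data.List.Properties using (++-identityʳ)
open import Data.List.Relation.Unary.Any using (here; there; any?)
open import Data.List.Relation.Unary.All as All using (All; []; _∷_; all?)
open import Data.List.Membership.Propositional using (_∈_; _∉_)
open import Data.List.Membership.DecPropositional _≟_ using (_∈?_)
open import Relation.Nullary using (Dec; no)
open import Relation.Nullary.Decidable using (toWitness; toWitnessFalse; map′; True; False)
open import Relation.Binary.PropositionalEquality using (_≡_; _≢_; refl; sym; trans; cong; cong₂)
open import Function.Bundles using (Equivalence; mk⇔)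
import Function.Properties.Equivalence

_≟ˡ_ : (l k : Lit) → Dec (l ≡ k)
pos a ≟ˡ pos b = map′ (cong pos) (λ { refl → refl }) (a ≟ b)
neg a ≟ˡ neg b = map′ (cong neg) (λ { refl → refl }) (a ≟ b)
mrg a ≟ˡ mrg b = map′ (cong mrg) (λ { refl → refl }) (a ≟ b)
pos _ ≟ˡ neg _ = no λ ()
pos _ ≟ˡ mrg _ = no λ ()
neg _ ≟ˡ pos _ = no λ ()
neg _ ≟ˡ mrg _ = no λ ()
mrg _ ≟ˡ pos _ = no λ ()
mrg _ ≟ˡ neg _ = no λ ()

open import Data.List.Relation.Binary.Subset.DecPropositional _≟ˡ_ using (_⊆?_)

≈-refl : ∀ {C} → C ≈ C
≈-refl _ = mk⇔ (λ m → m) (λ m → m)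

≈-reflexive : ∀ {C D} → C ≡ D → C ≈ D
≈-reflexive refl = ≈-refl

≈-dropDuplicateHead : ∀ {l C} → (l ∷ C) ≈ (l ∷ l ∷ C)
≈-dropDuplicateHead _ = mk⇔ there λ { (here e) → here e ; (there m) → m }

≈-sym : ∀ {C D} → C ≈ D → D ≈ C
≈-sym C≈D l = Function.Properties.Equivalence.sym (C≈D l)

≈-trans : ∀ {C D E} → C ≈ D → D ≈ E → C ≈ E
≈-trans C≈D D≈E l = Function.Properties.Equivalence.trans (C≈D l) (D≈E l)

∷-cong-≈ : ∀ {l C D} → C ≈ D → (l ∷ C) ≈ (l ∷ D)
∷-cong-≈ C≈D _ = mk⇔ (λ { (here e) → here e ; (there m) → there (Equivalence.to (C≈D _) m) })
                      (λ { (here e) → here e ; (there m) → there (Equivalence.from (C≈D _) m) })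

≈-by-decision : (C D : Clause) → {True (C ⊆? D)} → {True (D ⊆? C)} → C ≈ D
≈-by-decision C D {C⊆D} {D⊆C} _ = mk⇔ (toWitness C⊆D) (toWitness D⊆C)

∉-by-decision : ∀ v vs → {False (v ∈? vs)} → v ∉ vs
∉-by-decision v vs {v∉vs} = toWitnessFalse v∉vs

litTrue? : ∀ β l → Dec (litTrue β l)
litTrue? β (pos v) = β v ≟ᵇ true
litTrue? β (neg v) = β v ≟ᵇ false
litTrue? β (mrg v) = no λ ()

matrixTrue? : ∀ β M → Dec (matrixTrue β M)
matrixTrue? β = all? (any? (litTrue? β))

matrixTrue-by-decision : ∀ β M → {True (matrixTrue? β M)} → matrixTrue β M
matrixTrue-by-decision β M {βM} = toWitness βM

AgreeOn : (Var → Bool) → (Var → Bool) → Clause → Set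
AgreeOn β γ = All (λ l → β (var l) ≡ γ (var l))

litTrue-cong : ∀ {β γ} l → β (var l) ≡ γ (var l) → litTrue β l → litTrue γ l
litTrue-cong (pos v) β≡γ βv = trans (sym β≡γ) βv
litTrue-cong (neg v) β≡γ βv = trans (sym β≡γ) βv

clauseTrue-cong : ∀ {β γ C} → AgreeOn β γ C → clauseTrue β C → clauseTrue γ C
clauseTrue-cong (β≡γ ∷ _)   (here βl) = here (litTrue-cong _ β≡γ βl)
clauseTrue-cong (_ ∷ agree) (there βC) = there (clauseTrue-cong agree βC)

matrixTrue-cong : ∀ {β γ M} → All (AgreeOn β γ) M → matrixTrue β M → matrixTrue γ M
matrixTrue-cong []               []          = []
matrixTrue-cong (agree ∷ agrees) (βC ∷ βM) = clauseTrue-cong agree βC ∷ matrixTrue-cong agrees βM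

module _ {Φ : DQBF} where

  Derives-resp-≈ : ∀ {C D} → Derives Φ C → C ≈ D → Derives Φ D
  Derives-resp-≈ (axiom C₀∈M C₀≈C) C≈D = axiom C₀∈M (≈-trans C₀≈C C≈D)
  Derives-resp-≈ (∀-red w d w∈U E≈wC side) C≈D =
    ∀-red w d w∈U (≈-trans E≈wC (∷-cong-≈ C≈D))
          (λ l l∈D → side l (Equivalence.from (C≈D l) l∈D))
  Derives-resp-≈ (l∃r x C₁ C₂ U₁ U₂ d₁ d₂ x∈E A≈ B≈ shared U₁ᵘ U₂ᵘ vars≡ U₁∉Yₓ clash C≈) C≈D =
    l∃r x C₁ C₂ U₁ U₂ d₁ d₂ x∈E A≈ B≈ shared U₁ᵘ U₂ᵘ vars≡ U₁∉Yₓ clash (≈-trans (≈-sym C≈D) C≈)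

  resolve : ∀ x C₁ C₂ → x ∈ exist Φ →
            (∀ l₁ l₂ → l₁ ∈ C₁ → l₂ ∈ C₂ → var l₁ ≡ var l₂ → (l₁ ≡ l₂) × (l₁ ≢ mrg (var l₁))) →
            Derives Φ (C₁ ++ pos x ∷ []) → Derives Φ (C₂ ++ neg x ∷ []) → Derives Φ (C₁ ++ C₂)
  resolve x C₁ C₂ x∈E shared d₁ d₂ =
    l∃r x C₁ C₂ [] [] d₁ d₂ x∈E ≈-refl ≈-refl shared (λ _ ()) (λ _ ())
        (λ _ → mk⇔ (λ ()) (λ ())) (λ _ ()) (λ _ _ ())
        (≈-reflexive (cong (C₁ ++_) (sym (++-identityʳ C₂))))

  resolveMerging : ∀ l x u → l ≢ mrg (var l) → x ∈ exist Φ → u ∈ univ Φ → u ∉ dep Φ x →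
                   Derives Φ (l ∷ pos u ∷ pos x ∷ []) → Derives Φ (l ∷ neg u ∷ neg x ∷ []) →
                   Derives Φ (l ∷ mrg u ∷ [])
  resolveMerging l x u l-unmerged x∈E u∈U u∉Yₓ d₁ d₂ =
    l∃r x (l ∷ []) (l ∷ []) (pos u ∷ []) (neg u ∷ []) d₁ d₂ x∈E ≈-refl ≈-refl
        (λ { _ _ (here refl) (here refl) _ → refl , l-unmerged })
        (λ { _ (here refl) → u∈U })
        (λ { _ (here refl) → u∈U })
        (λ _ → mk⇔ (λ { (here e) → here e }) (λ { (here e) → here e }))
        (λ { _ (here refl) → u∉Yₓ })
        (λ { _ _ (here refl) (here refl) _ → inj₁ refl })
        ≈-dropDuplicateHead

  ∀-red-all : ∀ {C} → All (λ l → var l ∈ univ Φ) C → All (λ l → var l ∉ exist Φ) C →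
                          Derives Φ C → Refutable Φ
  ∀-red-all []                 _                  d = d
  ∀-red-all (w∈U ∷ universal) (_ ∷ nonExistential) d =
    ∀-red-all universal nonExistential
      (∀-red _ d w∈U ≈-refl (λ l l∈D l∈E → ⊥-elim (All.lookup nonExistential l∈D l∈E)))

_⇔ᵇ_ : Bool → Bool → Bool
true  ⇔ᵇ b = b
false ⇔ᵇ b = not b

model : Bool → Bool → Var → Bool
model a b 0 = a
model a b 1 = b
model a b 2 = a
model a b 3 = not b
model a b 4 = a ⇔ᵇ b
model a b _ = false

skolem : Var → (Var → Bool) → Bool
skolem x α = model (α 0) (α 1) x

model-satisfies : ∀ a b → matrixTrue (model a b) (matrix example)
model-satisfies true  true  = matrixTrue-by-decision (model true true) (matrix example)
model-satisfies true  false = matrixTrue-by-decision (model true false) (matrix example)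
model-satisfies false true  = matrixTrue-by-decision (model false true) (matrix example)
model-satisfies false false = matrixTrue-by-decision (model false false) (matrix example)

skolem-respects-dep : ∀ x → x ∈ exist example → DependsOnlyOn (dep example x) (skolem x)
skolem-respects-dep .2 (here refl)                 α β agree = agree 0 (here refl)
skolem-respects-dep .3 (there (here refl))         α β agree = cong not (agree 1 (here refl))
skolem-respects-dep .4 (there (there (here refl))) α β agree =
  cong₂ _⇔ᵇ_ (agree 0 (here refl)) (agree 1 (there (here refl)))

example-isTrue : IsTrue example
example-isTrue = skolem , skolem-respects-dep , λ α →
  matrixTrue-cong ((refl ∷ refl ∷ refl ∷ []) ∷ (refl ∷ refl ∷ refl ∷ []) ∷
                   (refl ∷ refl ∷ refl ∷ []) ∷ (refl ∷ refl ∷ refl ∷ []) ∷ [])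
                  (model-satisfies (α 0) (α 1))

z∨v* : Derives example (pos 4 ∷ mrg 1 ∷ [])
z∨v* = resolveMerging (pos 4) 2 1 (λ ()) (here refl) (there (here refl))
         (∉-by-decision 1 (0 ∷ []))
         (axiom (here refl) (≈-by-decision _ _))
         (axiom (there (here refl)) (≈-by-decision _ _))

¬z∨u* : Derives example (neg 4 ∷ mrg 0 ∷ [])
¬z∨u* = resolveMerging (neg 4) 3 0 (λ ()) (there (here refl)) (here refl)
          (∉-by-decision 0 (1 ∷ []))
          (axiom (there (there (here refl))) (≈-by-decision _ _))
          (axiom (there (there (there (here refl)))) (≈-by-decision _ _))

v*∨u* : Derives example (mrg 1 ∷ mrg 0 ∷ [])
v*∨u* = resolve 4 (mrg 1 ∷ []) (mrg 0 ∷ []) (there (there (here refl)))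
          (λ { _ _ (here refl) (here refl) () })
          (Derives-resp-≈ z∨v* (≈-by-decision _ _)) (Derives-resp-≈ ¬z∨u* (≈-by-decision _ _))

mainTheorem5 : IsTrue example × Refutable example
mainTheorem5 = example-isTrue ,
  ∀-red-all (there (here refl) ∷ here refl ∷ [])
                        (∉-by-decision 1 (exist example) ∷ ∉-by-decision 0 (exist example) ∷ [])
                        v*∨u*
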